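{- Let $G$ be a bipartite graph with vertex classes $L$ and $U$, and let $p$ be a positive real number with $|L|^{ -1} \leq p \leq |L|^{ -1}|U|^{ -1}E(L,U)$. Then for every $R \subseteq U$, \[\left(E(L,R) - p|L|\,|R|\right)^2 \leq |R|\left(\sum_{u \in U}\sum_{\substack{v_1, v_2 \in L\\ v_1 \neq v_2}}\left(\mathbf{1}_{v_1 \sim u}\mathbf{1}_{v_2 \sim u} - p^2\right) + E(L,U)\right),\] where the inner sum is over ordered pairs of distinct vertices.
   Context: For vertices $u,v$ of a graph, $u \sim v$ means $\{u,v\}$ is an edge, and $\mathbf{1}_{v\sim u}$ is $1$ if $v \sim u$ and $0$ otherwise. For vertex subsets $A, B$, $E(A,B) = \#\{(u,v) \in A \times B : u \sim v\}$.
   Formalization: The parameter p ranges over the positive rationals instead of the positive reals. -}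

module Defs where

open import Data.Bool using (Bool; true; false; if_then_else_)
open import Data.Nat using (ℕ; zero; suc)
open import Data.Fin using (Fin; zero; suc; _≟_)
open import Data.Fin.Subset using (Subset; _∈_)
open import Data.Fin.Subset.Properties using (_∈?_)
open import Data.Integer using (+_)
open import Data.Rational using (ℚ; 0ℚ; 1ℚ; _+_; _-_; _*_; _/_)
open import Relation.Nullary using (yes; no)

-- A bipartite graph with vertex classes L = Fin m and U = Fin n,
-- given by its adjacency relation between the classes (v ∼ u).
BipGraph : ℕ → ℕ → Set
BipGraph m n = Fin m → Fin n → Bool

sumℕ : ∀ {k} → (Fin k → ℕ) → ℕ
sumℕ {zero} f = 0
sumℕ {suc k} f = f zero Data.Nat.+ sumℕ (λ i → f (suc i))

sumℚ : ∀ {k} → (Fin k → ℚ) → ℚ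
sumℚ {zero} f = 0ℚ
sumℚ {suc k} f = f zero + sumℚ (λ i → f (suc i))

⟦_⟧ : ℕ → ℚ
⟦ k ⟧ = (+ k) / 1

𝟙 : Bool → ℕ
𝟙 true = 1
𝟙 false = 0

𝟙∈ : ∀ {n} → Fin n → Subset n → ℕ
𝟙∈ u R with u ∈? R
... | yes _ = 1
... | no _ = 0

E-LR : ∀ {m n} → BipGraph m n → Subset n → ℕ
E-LR G R = sumℕ λ v → sumℕ λ u → 𝟙∈ u R Data.Nat.* 𝟙 (G v u)

E-LU : ∀ {m n} → BipGraph m n → ℕ
E-LU G = sumℕ λ v → sumℕ λ u → 𝟙 (G v u)

codegSum : ∀ {m n} → BipGraph m n → ℚ → ℚ
codegSum G p = sumℚ λ u → sumℚ λ v₁ → sumℚ λ v₂ → term u v₁ v₂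
  where
    term : _ → _ → _ → ℚ
    term u v₁ v₂ with v₁ ≟ v₂
    ... | yes _ = 0ℚ
    ... | no _ = ⟦ 𝟙 (G v₁ u) Data.Nat.* 𝟙 (G v₂ u) ⟧ - p * p

{-# OPTIONS --safe #-}

-- Write d(u) for the degree of u ∈ U and x(u) = d(u) − p|L| for its excess over the
-- expected degree. Then E(L,R) − p|L||R| = Σ_{u∈R} x(u), so by Cauchy–Schwarz its square
-- is at most |R| Σ_{u∈U} x(u)². On the other side, u has d(u)² − d(u) ordered pairs of
-- distinct neighbours, so the codegree sum plus E(L,U) is Σ_u (d(u)² − |L|(|L|−1)p²),
-- which completes the square to Σ_u x(u)² + 2p|L| Σ_u x(u) + |U||L|p². The upper bound
-- on p says exactly that Σ_u x(u) = E(L,U) − p|L||U| is nonnegative.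

module Submission where

open import Algebra.Bundles using (CommutativeRing)
open import Data.Bool using (true; false)
open import Data.Fin using (Fin; zero; suc; punchIn)
open import Data.Fin.Properties using (punchInᵢ≢i) renaming (_≟_ to _≟ᶠ_)
open import Data.Fin.Subset using (Subset; ∣_∣; inside; outside)
open import Data.Fin.Subset.Properties using (_∈?_)
open import Data.Integer using (+_)
import Data.Integer.Properties as ℤ
open import Data.Nat as ℕ using (ℕ; zero; suc; NonZero)
import Data.Nat.Coprimality as Coprimality
open import Data.Rational
  using (ℚ; mkℚ; 0ℚ; 1ℚ; ½; _+_; _*_; _-_; -_; _/_; _≤_; Positive; nonNegative; nonPositive)
open import Data.Rational.Properties
open import Data.Rational.Solver using (module +-*-Solver)
open import Data.Sum using (inj₁; inj₂)
open import Data.Vec using (_∷_; [])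
open import Function using (_∘_)
open import Relation.Binary.PropositionalEquality
open import Relation.Nullary using (yes; no; contradiction)

open import Defs

open +-*-Solver using (solve; _:=_; _:+_; _:*_; _:-_; :-_; con)

open CommutativeRing +-*-commutativeRing using (semiring)
open import Algebra.Properties.Semiring.Sum semiring
  using (sum; sum-cong-≗; sum-remove; ∑-distrib-+; ∑-comm; *-distribˡ-sum; *-distribʳ-sum)

⟦⟧≡mkℚ : ∀ k → ⟦ k ⟧ ≡ mkℚ (+ k) 0 (Coprimality.sym (Coprimality.1-coprimeTo k))
⟦⟧≡mkℚ k = normalize-coprime (Coprimality.sym (Coprimality.1-coprimeTo k))

⟦⟧-homo-+ : ∀ a b → ⟦ a ℕ.+ b ⟧ ≡ ⟦ a ⟧ + ⟦ b ⟧
⟦⟧-homo-+ a b rewrite ⟦⟧≡mkℚ a | ⟦⟧≡mkℚ b =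
  cong (_/ 1) (trans (ℤ.pos-+ a b) (sym (cong₂ Data.Integer._+_ (ℤ.*-identityʳ (+ a)) (ℤ.*-identityʳ (+ b)))))

⟦⟧-homo-* : ∀ a b → ⟦ a ℕ.* b ⟧ ≡ ⟦ a ⟧ * ⟦ b ⟧
⟦⟧-homo-* a b rewrite ⟦⟧≡mkℚ a | ⟦⟧≡mkℚ b = cong (_/ 1) (ℤ.pos-* a b)

⟦⟧-nonNeg : ∀ k → 0ℚ ≤ ⟦ k ⟧
⟦⟧-nonNeg k = nonNegative⁻¹ ⟦ k ⟧ {{normalize-nonNeg k 1}}

1/n*⟦n⟧≡1 : ∀ n .{{_ : NonZero n}} → (+ 1 / n) * ⟦ n ⟧ ≡ 1ℚ
1/n*⟦n⟧≡1 (suc k) rewrite ⟦⟧≡mkℚ (suc k) | normalize-coprime {1} {k} (Coprimality.1-coprimeTo (suc k)) =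
  *-inverseˡ (mkℚ (+ suc k) 0 (Coprimality.sym (Coprimality.1-coprimeTo (suc k))))

*-nonNeg : ∀ {x y} → 0ℚ ≤ x → 0ℚ ≤ y → 0ℚ ≤ x * y
*-nonNeg {x} {y} 0≤x 0≤y = nonNegative⁻¹ (x * y) {{nonNeg*nonNeg⇒nonNeg x {{nonNegative 0≤x}} y {{nonNegative 0≤y}}}}

x≤y⇒0≤y-x : ∀ {x y} → x ≤ y → 0ℚ ≤ y - x
x≤y⇒0≤y-x {x} {y} x≤y = subst (_≤ y - x) (+-inverseʳ x) (+-monoˡ-≤ (- x) x≤y)

square-nonNeg : ∀ x → 0ℚ ≤ x * x
square-nonNeg x with ≤-total 0ℚ x
... | inj₁ 0≤x = *-nonNeg 0≤x 0≤x
... | inj₂ x≤0 = nonNegative⁻¹ (x * x) {{nonPos*nonPos⇒nonPos x {{nonPositive x≤0}} x {{nonPositive x≤0}}}}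

x+x≤y+y⇒x≤y : ∀ {x y} → x + x ≤ y + y → x ≤ y
x+x≤y+y⇒x≤y {x} {y} h = subst₂ _≤_ (halve x) (halve y) (*-monoˡ-≤-nonNeg ½ {{normalize-nonNeg 1 2}} h)
  where
  halve : ∀ z → ½ * (z + z) ≡ z
  halve = solve 1 (λ z → con ½ :* (z :+ z) := z) refl

p≤e/mn⇒pmn≤e : ∀ m n .{{_ : NonZero m}} .{{_ : NonZero n}} {p e} →
               p ≤ (+ 1 / m) * (+ 1 / n) * e → p * (⟦ m ⟧ * ⟦ n ⟧) ≤ e
p≤e/mn⇒pmn≤e m n {p} {e} p≤e/mn = begin
  p * (M * N)                                ≤⟨ *-monoʳ-≤-nonNeg (M * N) {{nonNegative (*-nonNeg (⟦⟧-nonNeg m) (⟦⟧-nonNeg n))}} p≤e/mn ⟩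
  (+ 1 / m) * (+ 1 / n) * e * (M * N)        ≡⟨ regroup (+ 1 / m) (+ 1 / n) e M N ⟩
  ((+ 1 / m) * M) * ((+ 1 / n) * N) * e      ≡⟨ cong₂ (λ x y → x * y * e) (1/n*⟦n⟧≡1 m) (1/n*⟦n⟧≡1 n) ⟩
  1ℚ * 1ℚ * e                                ≡⟨ *-identityˡ e ⟩
  e                                          ∎
  where
  open ≤-Reasoning
  M = ⟦ m ⟧
  N = ⟦ n ⟧
  regroup : ∀ a b e M N → a * b * e * (M * N) ≡ (a * M) * (b * N) * e
  regroup = solve 5 (λ a b e M N → a :* b :* e :* (M :* N) := (a :* M) :* (b :* N) :* e) refl

sumℕ-cong : ∀ {k} {f g : Fin k → ℕ} → (∀ i → f i ≡ g i) → sumℕ f ≡ sumℕ g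
sumℕ-cong {zero}  f≗g = refl
sumℕ-cong {suc k} f≗g = cong₂ ℕ._+_ (f≗g zero) (sumℕ-cong (f≗g ∘ suc))

sumℚ≡sum : ∀ {k} (f : Fin k → ℚ) → sumℚ f ≡ sum f
sumℚ≡sum {zero}  f = refl
sumℚ≡sum {suc k} f = cong (_+_ (f zero)) (sumℚ≡sum (f ∘ suc))

⟦sumℕ⟧ : ∀ {k} (f : Fin k → ℕ) → ⟦ sumℕ f ⟧ ≡ sum (⟦_⟧ ∘ f)
⟦sumℕ⟧ {zero}  f = refl
⟦sumℕ⟧ {suc k} f = trans (⟦⟧-homo-+ (f zero) (sumℕ (f ∘ suc))) (cong (_+_ ⟦ f zero ⟧) (⟦sumℕ⟧ (f ∘ suc)))

⟦sumℕ²⟧ : ∀ {k l} (f : Fin k → Fin l → ℕ) →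
          ⟦ sumℕ (λ i → sumℕ (f i)) ⟧ ≡ sum (λ i → sum (⟦_⟧ ∘ f i))
⟦sumℕ²⟧ f = trans (⟦sumℕ⟧ (λ i → sumℕ (f i))) (sum-cong-≗ (⟦sumℕ⟧ ∘ f))

sum-const : ∀ k c → sum {k} (λ _ → c) ≡ ⟦ k ⟧ * c
sum-const zero    c = sym (*-zeroˡ c)
sum-const (suc k) c = begin
  c + sum {k} (λ _ → c)  ≡⟨ cong (_+_ c) (sum-const k c) ⟩
  c + ⟦ k ⟧ * c          ≡⟨ step c ⟦ k ⟧ ⟩
  (1ℚ + ⟦ k ⟧) * c       ≡⟨ cong (_* c) (⟦⟧-homo-+ 1 k) ⟨
  ⟦ suc k ⟧ * c          ∎
  where
  open ≡-Reasoning
  step : ∀ c K → c + K * c ≡ (1ℚ + K) * c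
  step = solve 2 (λ c K → c :+ K :* c := (con 1ℚ :+ K) :* c) refl

sum-affine : ∀ {k} α (f : Fin k → ℚ) β → sum (λ i → α * f i + β) ≡ α * sum f + ⟦ k ⟧ * β
sum-affine {k} α f β = trans (∑-distrib-+ (λ i → α * f i) (λ _ → β))
                         (cong₂ _+_ (sym (*-distribˡ-sum α f)) (sum-const k β))

sum-*-sum : ∀ {k l} (f : Fin k → ℚ) (g : Fin l → ℚ) →
            sum f * sum g ≡ sum (λ i → sum (λ j → f i * g j))
sum-*-sum f g = trans (*-distribʳ-sum (sum g) f) (sum-cong-≗ (λ i → *-distribˡ-sum (f i) g))

sum-nonNeg : ∀ {k} {f : Fin k → ℚ} → (∀ i → 0ℚ ≤ f i) → 0ℚ ≤ sum f
sum-nonNeg {zero}  f≥0 = ≤-refl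
sum-nonNeg {suc k} f≥0 = +-mono-≤ (f≥0 zero) (sum-nonNeg (f≥0 ∘ suc))

sum-punctured : ∀ {k} (i : Fin k) {t w : Fin k → ℚ} →
                w i ≡ 0ℚ → (∀ j → i ≢ j → w j ≡ t j) → sum w ≡ sum t - t i
sum-punctured {suc k} i {t} {w} wᵢ≡0 w≗t = begin
  sum w                      ≡⟨ sum-remove {i = i} w ⟩
  w i + sum (w ∘ punchIn i)  ≡⟨ cong₂ _+_ wᵢ≡0 (sum-cong-≗ (λ j → w≗t (punchIn i j) (≢-sym (punchInᵢ≢i i j)))) ⟩
  0ℚ + rest                  ≡⟨ cancel (t i) rest ⟩
  (t i + rest) - t i         ≡⟨ cong (_- t i) (sum-remove {i = i} t) ⟨
  sum t - t i                ∎
  where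
  open ≡-Reasoning
  rest = sum (t ∘ punchIn i)
  cancel : ∀ a r → 0ℚ + r ≡ (a + r) - a
  cancel = solve 2 (λ a r → con 0ℚ :+ r := (a :+ r) :- a) refl

∑∑-distrib-+ : ∀ {k l} (f g : Fin k → Fin l → ℚ) →
               sum (λ i → sum (λ j → f i j + g i j)) ≡ sum (λ i → sum (f i)) + sum (λ i → sum (g i))
∑∑-distrib-+ f g = trans (sum-cong-≗ (λ i → ∑-distrib-+ (f i) (g i))) (∑-distrib-+ (λ i → sum (f i)) (λ i → sum (g i)))

lagrange-identity : ∀ {k} (a b : Fin k → ℚ) →
  let A = sum (λ i → a i * a i); B = sum (λ i → b i * b i); C = sum (λ i → a i * b i) in
  A * B + B * A ≡ sum (λ i → sum (λ j → (a i * b j - a j * b i) * (a i * b j - a j * b i))) + (C * C + C * C)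
lagrange-identity a b = begin
  A * B + B * A
    ≡⟨ cong₂ _+_ (sum-*-sum a² b²) (sum-*-sum b² a²) ⟩
  sum (λ i → sum (λ j → a² i * b² j)) + sum (λ i → sum (λ j → b² i * a² j))
    ≡⟨ ∑∑-distrib-+ (λ i j → a² i * b² j) (λ i j → b² i * a² j) ⟨
  sum (λ i → sum (λ j → a² i * b² j + b² i * a² j))
    ≡⟨ sum-cong-≗ (λ i → sum-cong-≗ (λ j → expand (a i) (b i) (a j) (b j))) ⟩
  sum (λ i → sum (λ j → Δ i j * Δ i j + (ab i * ab j + ab i * ab j)))
    ≡⟨ ∑∑-distrib-+ (λ i j → Δ i j * Δ i j) (λ i j → ab i * ab j + ab i * ab j) ⟩
  S + sum (λ i → sum (λ j → ab i * ab j + ab i * ab j))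
    ≡⟨ cong (_+_ S) (∑∑-distrib-+ (λ i j → ab i * ab j) (λ i j → ab i * ab j)) ⟩
  S + (sum (λ i → sum (λ j → ab i * ab j)) + sum (λ i → sum (λ j → ab i * ab j)))
    ≡⟨ cong (λ z → S + (z + z)) (sum-*-sum ab ab) ⟨
  S + (C * C + C * C) ∎
  where
  open ≡-Reasoning
  a² b² ab : _ → ℚ
  a² i = a i * a i
  b² i = b i * b i
  ab i = a i * b i
  Δ : _ → _ → ℚ
  Δ i j = a i * b j - a j * b i
  A = sum a²
  B = sum b²
  C = sum ab
  S = sum (λ i → sum (λ j → Δ i j * Δ i j))
  expand : ∀ x y z w → (x * x) * (w * w) + (y * y) * (z * z)
                       ≡ (x * w - z * y) * (x * w - z * y) + ((x * y) * (z * w) + (x * y) * (z * w))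
  expand = solve 4 (λ x y z w → (x :* x) :* (w :* w) :+ (y :* y) :* (z :* z)
                           := (x :* w :- z :* y) :* (x :* w :- z :* y) :+ ((x :* y) :* (z :* w) :+ (x :* y) :* (z :* w))) refl

cauchy-schwarz : ∀ {k} (a b : Fin k → ℚ) →
  sum (λ i → a i * b i) * sum (λ i → a i * b i) ≤ sum (λ i → a i * a i) * sum (λ i → b i * b i)
cauchy-schwarz a b = x+x≤y+y⇒x≤y (begin
  C * C + C * C         ≡⟨ +-identityˡ (C * C + C * C) ⟨
  0ℚ + (C * C + C * C)  ≤⟨ +-monoˡ-≤ (C * C + C * C) (sum-nonNeg (λ i → sum-nonNeg (λ j → square-nonNeg (Δ i j)))) ⟩
  S + (C * C + C * C)   ≡⟨ lagrange-identity a b ⟨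
  A * B + B * A         ≡⟨ cong (_+_ (A * B)) (*-comm B A) ⟩
  A * B + A * B         ∎)
  where
  open ≤-Reasoning
  A = sum (λ i → a i * a i)
  B = sum (λ i → b i * b i)
  C = sum (λ i → a i * b i)
  Δ : _ → _ → ℚ
  Δ i j = a i * b j - a j * b i
  S = sum (λ i → sum (λ j → Δ i j * Δ i j))

𝟙-idem : ∀ b → ⟦ 𝟙 b ⟧ * ⟦ 𝟙 b ⟧ ≡ ⟦ 𝟙 b ⟧
𝟙-idem true  = refl
𝟙-idem false = refl

𝟙∈-idem : ∀ {n} (u : Fin n) (R : Subset n) → ⟦ 𝟙∈ u R ⟧ * ⟦ 𝟙∈ u R ⟧ ≡ ⟦ 𝟙∈ u R ⟧
𝟙∈-idem u R with u ∈? R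
... | yes _ = refl
... | no  _ = refl

𝟙∈-suc : ∀ {n} (u : Fin n) s (R : Subset n) → 𝟙∈ (suc u) (s ∷ R) ≡ 𝟙∈ u R
𝟙∈-suc u s R with u ∈? R
... | yes _ = refl
... | no  _ = refl

∣∣≡sumℕ-𝟙∈ : ∀ {n} (R : Subset n) → ∣ R ∣ ≡ sumℕ (λ u → 𝟙∈ u R)
∣∣≡sumℕ-𝟙∈ []          = refl
∣∣≡sumℕ-𝟙∈ (inside ∷ R)  = cong suc (trans (∣∣≡sumℕ-𝟙∈ R) (sym (sumℕ-cong (λ u → 𝟙∈-suc u inside R))))
∣∣≡sumℕ-𝟙∈ (outside ∷ R) = trans (∣∣≡sumℕ-𝟙∈ R) (sym (sumℕ-cong (λ u → 𝟙∈-suc u outside R)))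

⟦∣∣⟧≡sum-𝟙∈ : ∀ {n} (R : Subset n) → ⟦ ∣ R ∣ ⟧ ≡ sum (λ u → ⟦ 𝟙∈ u R ⟧)
⟦∣∣⟧≡sum-𝟙∈ R = trans (cong ⟦_⟧ (∣∣≡sumℕ-𝟙∈ R)) (⟦sumℕ⟧ (λ u → 𝟙∈ u R))

sum-𝟙∈²≡∣∣ : ∀ {n} (R : Subset n) → sum (λ u → ⟦ 𝟙∈ u R ⟧ * ⟦ 𝟙∈ u R ⟧) ≡ ⟦ ∣ R ∣ ⟧
sum-𝟙∈²≡∣∣ R = trans (sum-cong-≗ (λ u → 𝟙∈-idem u R)) (sym (⟦∣∣⟧≡sum-𝟙∈ R))

module _ {m n} (G : BipGraph m n) where

  degree : Fin n → ℚ
  degree u = sum (λ v → ⟦ 𝟙 (G v u) ⟧)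

  excess : ℚ → Fin n → ℚ
  excess p u = degree u - p * ⟦ m ⟧

  E-LU≡sum-degree : ⟦ E-LU G ⟧ ≡ sum degree
  E-LU≡sum-degree = trans (⟦sumℕ²⟧ (λ v u → 𝟙 (G v u))) (∑-comm (λ v u → ⟦ 𝟙 (G v u) ⟧))

  E-LR≡sum-degree : ∀ R → ⟦ E-LR G R ⟧ ≡ sum (λ u → ⟦ 𝟙∈ u R ⟧ * degree u)
  E-LR≡sum-degree R = begin
    ⟦ E-LR G R ⟧
      ≡⟨ ⟦sumℕ²⟧ (λ v u → 𝟙∈ u R ℕ.* 𝟙 (G v u)) ⟩
    sum (λ v → sum (λ u → ⟦ 𝟙∈ u R ℕ.* 𝟙 (G v u) ⟧))
      ≡⟨ sum-cong-≗ (λ v → sum-cong-≗ (λ u → ⟦⟧-homo-* (𝟙∈ u R) (𝟙 (G v u)))) ⟩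
    sum (λ v → sum (λ u → ⟦ 𝟙∈ u R ⟧ * ⟦ 𝟙 (G v u) ⟧))
      ≡⟨ ∑-comm (λ v u → ⟦ 𝟙∈ u R ⟧ * ⟦ 𝟙 (G v u) ⟧) ⟩
    sum (λ u → sum (λ v → ⟦ 𝟙∈ u R ⟧ * ⟦ 𝟙 (G v u) ⟧))
      ≡⟨ sum-cong-≗ (λ u → *-distribˡ-sum ⟦ 𝟙∈ u R ⟧ (λ v → ⟦ 𝟙 (G v u) ⟧)) ⟨
    sum (λ u → ⟦ 𝟙∈ u R ⟧ * degree u) ∎
    where open ≡-Reasoning

  E-LR-deviation≡sum-excess : ∀ p R →
    ⟦ E-LR G R ⟧ - p * ⟦ m ⟧ * ⟦ ∣ R ∣ ⟧ ≡ sum (λ u → ⟦ 𝟙∈ u R ⟧ * excess p u)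
  E-LR-deviation≡sum-excess p R = begin
    ⟦ E-LR G R ⟧ - q * ⟦ ∣ R ∣ ⟧
      ≡⟨ cong₂ (λ e r → e - q * r) (E-LR≡sum-degree R) (⟦∣∣⟧≡sum-𝟙∈ R) ⟩
    sum (λ u → χ u * degree u) - q * sum χ
      ≡⟨ cong (_+_ (sum (λ u → χ u * degree u))) (neg-distribˡ-* q (sum χ)) ⟩
    sum (λ u → χ u * degree u) + (- q) * sum χ
      ≡⟨ cong (_+_ (sum (λ u → χ u * degree u))) (*-distribˡ-sum (- q) χ) ⟩
    sum (λ u → χ u * degree u) + sum (λ u → (- q) * χ u)
      ≡⟨ ∑-distrib-+ (λ u → χ u * degree u) (λ u → (- q) * χ u) ⟨
    sum (λ u → χ u * degree u + (- q) * χ u)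
      ≡⟨ sum-cong-≗ (λ u → factor (χ u) (degree u) q) ⟩
    sum (λ u → χ u * excess p u) ∎
    where
    open ≡-Reasoning
    q = p * ⟦ m ⟧
    χ : Fin n → ℚ
    χ u = ⟦ 𝟙∈ u R ⟧
    factor : ∀ c d q → c * d + (- q) * c ≡ c * (d - q)
    factor = solve 3 (λ c d q → c :* d :+ (:- q) :* c := c :* (d :- q)) refl

  sum-excess : ∀ p → sum (excess p) ≡ ⟦ E-LU G ⟧ - p * (⟦ m ⟧ * ⟦ n ⟧)
  sum-excess p = begin
    sum (λ u → degree u - p * ⟦ m ⟧)
      ≡⟨ ∑-distrib-+ degree (λ _ → - (p * ⟦ m ⟧)) ⟩
    sum degree + sum {n} (λ _ → - (p * ⟦ m ⟧))
      ≡⟨ cong₂ _+_ (sym E-LU≡sum-degree) (sum-const n (- (p * ⟦ m ⟧))) ⟩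
    ⟦ E-LU G ⟧ + ⟦ n ⟧ * - (p * ⟦ m ⟧)
      ≡⟨ regroup ⟦ E-LU G ⟧ p ⟦ m ⟧ ⟦ n ⟧ ⟩
    ⟦ E-LU G ⟧ - p * (⟦ m ⟧ * ⟦ n ⟧) ∎
    where
    open ≡-Reasoning
    regroup : ∀ e p M N → e + N * - (p * M) ≡ e - p * (M * N)
    regroup = solve 4 (λ e p M N → e :+ N :* (:- (p :* M)) := e :- p :* (M :* N)) refl

  -- Defs binds the summand of codegSum in a where-block, out of reach by name;
  -- unifying against the refl below recovers it.
  mutual
    codegSummand : ℚ → Fin n → Fin m → Fin m → ℚ
    codegSummand = _

    codegSum≡sumℚ-codegSummand : ∀ p →
      codegSum G p ≡ sumℚ (λ u → sumℚ (λ v₁ → sumℚ (codegSummand p u v₁)))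
    codegSum≡sumℚ-codegSummand p = refl

  codegSummand-diagonal : ∀ p u v → codegSummand p u v v ≡ 0ℚ
  codegSummand-diagonal p u v with v ≟ᶠ v
  ... | yes _  = refl
  ... | no v≢v = contradiction refl v≢v

  codegSummand-offDiagonal : ∀ p u {v₁ v₂} → v₁ ≢ v₂ →
    codegSummand p u v₁ v₂ ≡ ⟦ 𝟙 (G v₁ u) ⟧ * ⟦ 𝟙 (G v₂ u) ⟧ - p * p
  codegSummand-offDiagonal p u {v₁} {v₂} v₁≢v₂ with v₁ ≟ᶠ v₂
  ... | yes v₁≡v₂ = contradiction v₁≡v₂ v₁≢v₂
  ... | no _      = cong (_- p * p) (⟦⟧-homo-* (𝟙 (G v₁ u)) (𝟙 (G v₂ u)))

  codegSum≡sum-codegSummand : ∀ p →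
    codegSum G p ≡ sum (λ u → sum (λ v₁ → sum (codegSummand p u v₁)))
  codegSum≡sum-codegSummand p =
    trans (codegSum≡sumℚ-codegSummand p)
      (trans (sumℚ≡sum (λ u → sumℚ (λ v₁ → sumℚ (codegSummand p u v₁)))) (sum-cong-≗ (λ u →
        trans (sumℚ≡sum (λ v₁ → sumℚ (codegSummand p u v₁))) (sum-cong-≗ (λ v₁ → sumℚ≡sum (codegSummand p u v₁))))))

  codegSum-row+degree : ∀ p u →
    sum (λ v₁ → sum (codegSummand p u v₁)) + degree u
      ≡ excess p u * excess p u + ((p * ⟦ m ⟧ + p * ⟦ m ⟧) * excess p u + ⟦ m ⟧ * (p * p))
  codegSum-row+degree p u = begin
    sum (λ v₁ → sum (codegSummand p u v₁)) + d
      ≡⟨ cong (_+ d) (sum-cong-≗ inner-sum) ⟩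
    sum (λ v₁ → (d - 1ℚ) * a v₁ + (p * p - M * (p * p))) + d
      ≡⟨ cong (_+ d) (sum-affine (d - 1ℚ) a (p * p - M * (p * p))) ⟩
    (d - 1ℚ) * d + M * (p * p - M * (p * p)) + d
      ≡⟨ complete-square d p M ⟩
    (d - p * M) * (d - p * M) + ((p * M + p * M) * (d - p * M) + M * (p * p)) ∎
    where
    open ≡-Reasoning
    M = ⟦ m ⟧
    d = degree u
    a : Fin m → ℚ
    a v = ⟦ 𝟙 (G v u) ⟧
    complete-square : ∀ d p M → (d - 1ℚ) * d + M * (p * p - M * (p * p)) + d
      ≡ (d - p * M) * (d - p * M) + ((p * M + p * M) * (d - p * M) + M * (p * p))
    complete-square = solve 3 (λ d p M → (d :- con 1ℚ) :* d :+ M :* (p :* p :- M :* (p :* p)) :+ d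
      := (d :- p :* M) :* (d :- p :* M) :+ ((p :* M :+ p :* M) :* (d :- p :* M) :+ M :* (p :* p))) refl
    collect : ∀ a d p M → (a * d + M * - (p * p)) - (a - p * p) ≡ (d - 1ℚ) * a + (p * p - M * (p * p))
    collect = solve 4 (λ a d p M → (a :* d :+ M :* (:- (p :* p))) :- (a :- p :* p)
      := (d :- con 1ℚ) :* a :+ (p :* p :- M :* (p :* p))) refl
    inner-sum : ∀ v₁ → sum (codegSummand p u v₁) ≡ (d - 1ℚ) * a v₁ + (p * p - M * (p * p))
    inner-sum v₁ = begin
      sum (codegSummand p u v₁)
        ≡⟨ sum-punctured v₁ (codegSummand-diagonal p u v₁) (λ _ → codegSummand-offDiagonal p u) ⟩
      sum (λ v₂ → a v₁ * a v₂ - p * p) - (a v₁ * a v₁ - p * p)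
        ≡⟨ cong₂ _-_ (sum-affine (a v₁) a (- (p * p))) (cong (_- p * p) (𝟙-idem (G v₁ u))) ⟩
      (a v₁ * d + M * - (p * p)) - (a v₁ - p * p)
        ≡⟨ collect (a v₁) d p M ⟩
      (d - 1ℚ) * a v₁ + (p * p - M * (p * p)) ∎

  codegSum+E-LU : ∀ p → codegSum G p + ⟦ E-LU G ⟧
    ≡ sum (λ u → excess p u * excess p u) + ((p * ⟦ m ⟧ + p * ⟦ m ⟧) * sum (excess p) + ⟦ n ⟧ * (⟦ m ⟧ * (p * p)))
  codegSum+E-LU p = begin
    codegSum G p + ⟦ E-LU G ⟧
      ≡⟨ cong₂ _+_ (codegSum≡sum-codegSummand p) E-LU≡sum-degree ⟩
    sum row + sum degree
      ≡⟨ ∑-distrib-+ row degree ⟨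
    sum (λ u → row u + degree u)
      ≡⟨ sum-cong-≗ (codegSum-row+degree p) ⟩
    sum (λ u → x u * x u + (c * x u + ⟦ m ⟧ * (p * p)))
      ≡⟨ ∑-distrib-+ (λ u → x u * x u) (λ u → c * x u + ⟦ m ⟧ * (p * p)) ⟩
    sum (λ u → x u * x u) + sum (λ u → c * x u + ⟦ m ⟧ * (p * p))
      ≡⟨ cong (_+_ (sum (λ u → x u * x u))) (sum-affine c x (⟦ m ⟧ * (p * p))) ⟩
    sum (λ u → x u * x u) + (c * sum x + ⟦ n ⟧ * (⟦ m ⟧ * (p * p))) ∎
    where
    open ≡-Reasoning
    x = excess p
    c = p * ⟦ m ⟧ + p * ⟦ m ⟧
    row : Fin n → ℚ
    row u = sum (λ v₁ → sum (codegSummand p u v₁))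

sum-excess²≤codegSum+E-LU : ∀ {m n} .{{_ : NonZero m}} .{{_ : NonZero n}} (G : BipGraph m n) {p} →
  0ℚ ≤ p → p ≤ (+ 1 / m) * (+ 1 / n) * ⟦ E-LU G ⟧ →
  sum (λ u → excess G p u * excess G p u) ≤ codegSum G p + ⟦ E-LU G ⟧
sum-excess²≤codegSum+E-LU {m} {n} G {p} 0≤p p≤E/mn = begin
  sum (λ u → x u * x u)                                   ≡⟨ +-identityʳ (sum (λ u → x u * x u)) ⟨
  sum (λ u → x u * x u) + 0ℚ                              ≤⟨ +-monoʳ-≤ (sum (λ u → x u * x u)) slack≥0 ⟩
  sum (λ u → x u * x u) + (c * sum x + N * (M * (p * p))) ≡⟨ codegSum+E-LU G p ⟨
  codegSum G p + ⟦ E-LU G ⟧                               ∎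
  where
  open ≤-Reasoning
  M = ⟦ m ⟧
  N = ⟦ n ⟧
  x = excess G p
  c = p * M + p * M
  pM≥0 : 0ℚ ≤ p * M
  pM≥0 = *-nonNeg 0≤p (⟦⟧-nonNeg m)
  sum-x≥0 : 0ℚ ≤ sum x
  sum-x≥0 = subst (0ℚ ≤_) (sym (sum-excess G p)) (x≤y⇒0≤y-x (p≤e/mn⇒pmn≤e m n p≤E/mn))
  slack≥0 : 0ℚ ≤ c * sum x + N * (M * (p * p))
  slack≥0 = +-mono-≤ (*-nonNeg (+-mono-≤ pM≥0 pM≥0) sum-x≥0)
                     (*-nonNeg (⟦⟧-nonNeg n) (*-nonNeg (⟦⟧-nonNeg m) (square-nonNeg p)))

theorem2p1 : (m n : ℕ) → .{{_ : NonZero m}} → .{{_ : NonZero n}} →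
    (G : BipGraph m n) (p : ℚ) → Positive p →
    (+ 1) / m ≤ p →
    p ≤ ((+ 1) / m) * ((+ 1) / n) * ⟦ E-LU G ⟧ →
    (R : Subset n) →
    (⟦ E-LR G R ⟧ - p * ⟦ m ⟧ * ⟦ ∣ R ∣ ⟧) * (⟦ E-LR G R ⟧ - p * ⟦ m ⟧ * ⟦ ∣ R ∣ ⟧)
      ≤ ⟦ ∣ R ∣ ⟧ * (codegSum G p + ⟦ E-LU G ⟧)
theorem2p1 m n G p p>0 _ p≤E/mn R = begin
  (⟦ E-LR G R ⟧ - p * ⟦ m ⟧ * ⟦ ∣ R ∣ ⟧) * (⟦ E-LR G R ⟧ - p * ⟦ m ⟧ * ⟦ ∣ R ∣ ⟧)
    ≡⟨ cong (λ z → z * z) (E-LR-deviation≡sum-excess G p R) ⟩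
  sum (λ u → χ u * x u) * sum (λ u → χ u * x u)
    ≤⟨ cauchy-schwarz χ x ⟩
  sum (λ u → χ u * χ u) * sum (λ u → x u * x u)
    ≡⟨ cong (_* sum (λ u → x u * x u)) (sum-𝟙∈²≡∣∣ R) ⟩
  ⟦ ∣ R ∣ ⟧ * sum (λ u → x u * x u)
    ≤⟨ *-monoˡ-≤-nonNeg ⟦ ∣ R ∣ ⟧ {{nonNegative (⟦⟧-nonNeg ∣ R ∣)}} (sum-excess²≤codegSum+E-LU G 0≤p p≤E/mn) ⟩
  ⟦ ∣ R ∣ ⟧ * (codegSum G p + ⟦ E-LU G ⟧) ∎
  where
  open ≤-Reasoning
  0≤p = <⇒≤ (positive⁻¹ p {{p>0}})
  χ : Fin n → ℚ
  χ u = ⟦ 𝟙∈ u R ⟧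
  x = excess G p
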